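{- Let $n\ge3$. The reduced cohomology $\widetilde H^i(\Delta_n^{n-2})$ vanishes for all $i\ge\binom n2-\lfloor\frac{n+1}{3}\rfloor-1$.
   Context: For $0<i<n$, a graph on $[n]$ is $i$-connected if deleting any $j<i$ of its vertices leaves a connected graph. $\Delta_n^{n-2}$ is the simplicial complex on vertex set $\binom{[n]}{2}$ whose faces are the edge sets of not $(n-2)$-connected graphs on $[n]$. Cohomology has integer coefficients. -}

module Defs where

open import Data.Bool using (Bool; true; false; if_then_else_; _∧_)
open import Data.Nat using (ℕ; zero; suc; _<_; _<ᵇ_; _∸_)
open import Data.Fin using (Fin; toℕ)
open import Data.Fin.Subset using (Subset; _∈_; _∉_; ∣_∣)
open import Data.Vec using (_[_]≔_)
import Data.Vec as V
open import Data.List using (List; []; _∷_; concatMap; allFin; length; lookup)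
open import Data.Integer using (ℤ; 0ℤ; 1ℤ; -1ℤ; _+_; _*_)
open import Data.Product using (_×_; _,_; Σ; ∃)
open import Data.Sum using (_⊎_)
open import Relation.Binary.PropositionalEquality using (_≡_)
open import Relation.Nullary using (¬_)

sumFin : ∀ {m} → (Fin m → ℤ) → ℤ
sumFin {zero}  f = 0ℤ
sumFin {suc m} f = f Fin.zero + sumFin (λ k → f (Fin.suc k))
  where import Data.Fin as Fin

prodFin : ∀ {m} → (Fin m → ℤ) → ℤ
prodFin {zero}  f = 1ℤ
prodFin {suc m} f = f Fin.zero * prodFin (λ k → f (Fin.suc k))
  where import Data.Fin as Fin

-- A face is a subset σ : Subset m; a k-simplex is a face with k+1
-- vertices.  Vertices are ordered by the natural order on Fin m.
-- A cochain is a function Subset m → ℤ (only its values on faces of the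
-- relevant size matter).  The empty face is included, so the cochain
-- complex is the augmented one and we obtain REDUCED cohomology.

sgn : ∀ {m} → Subset m → Fin m → ℤ
sgn τ j = prodFin (λ k → if V.lookup τ k ∧ (toℕ k <ᵇ toℕ j) then -1ℤ else 1ℤ)

δ : ∀ {m} → (Subset m → ℤ) → Subset m → ℤ
δ g τ = sumFin (λ j → if V.lookup τ j then sgn τ j * g (τ [ j ]≔ false) else 0ℤ)

-- H̃^i(K; ℤ) = 0 for the complex K on Fin m with faces IsFace:
-- every i-cocycle is an i-coboundary (i-simplices have i+1 vertices).
ReducedCohomVanishes : ∀ m → (Subset m → Set) → ℕ → Set
ReducedCohomVanishes m IsFace i =
  (f : Subset m → ℤ) →
  (∀ τ → IsFace τ → ∣ τ ∣ ≡ suc (suc i) → δ f τ ≡ 0ℤ) →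
  Σ (Subset m → ℤ) λ g → ∀ σ → IsFace σ → ∣ σ ∣ ≡ suc i → f σ ≡ δ g σ

edges : (n : ℕ) → List (Fin n × Fin n)
edges n = concatMap (λ b → concatMap (λ a → if toℕ a <ᵇ toℕ b then (a , b) ∷ [] else [])
                                      (allFin n)) (allFin n)

-- number of edges of K_n (equals n choose 2)
E : ℕ → ℕ
E n = length (edges n)

Graph : ℕ → Set
Graph n = Subset (E n)

Adj : ∀ {n} → Graph n → Fin n → Fin n → Set
Adj {n} G a b = ∃ λ e → e ∈ G × (lookup (edges n) e ≡ (a , b) ⊎ lookup (edges n) e ≡ (b , a))

data Reach (n : ℕ) (G : Graph n) (S : Subset n) (u : Fin n) : Fin n → Set where
  here : Reach n G S u u
  step : ∀ {v w} → Reach n G S u v → Adj G v w → w ∉ S → Reach n G S u w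

ConnectedMinus : ∀ n → Graph n → Subset n → Set
ConnectedMinus n G S = ∀ u v → u ∉ S → v ∉ S → Reach n G S u v

IConnected : ∀ n → ℕ → Graph n → Set
IConnected n i G = ∀ S → ∣ S ∣ < i → ConnectedMinus n G S

DeltaFace : ∀ n → Graph n → Set
DeltaFace n G = ¬ IConnected n (n ∸ 2) G

-- A graph on [n] is (n−2)-connected exactly when its missing edges form a matching, so the faces of Δ
-- are the edge sets whose complement is not a matching.  Extend an i-cocycle f of Δ by zero to the full
-- simplex on the edges of K_n: its coboundary is a cocycle supported on the edge sets whose complement
-- is a matching with c = (n choose 2) − i − 2 edges, i.e. a cocycle of the matching complex.  Such a
-- cocycle is the coboundary of a cochain supported on complements of (c+1)-edge matchings as soon as
-- 3c + 2 ≤ n: for each edge e at a vertex v, adding δ (cone e ω), where δ ω = link e φ is solved by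
-- induction on c, moves the support off v; after clearing two vertices v and x the cocycle is coned
-- off the edge vx.  Subtracting this primitive from the extension leaves a cocycle of the full simplex,
-- hence a coboundary, and the primitive vanishes on Δ.  The hypothesis on i amounts to 3c + 2 ≤ n.

module Submission where

open import Defs
open import Algebra.Bundles using (AbelianGroup)
open import Data.Bool using (Bool; true; false; if_then_else_; _∧_)
open import Data.Bool.Properties using () renaming (_≟_ to _≟ᵇ_)
open import Data.Empty using (⊥; ⊥-elim)
open import Data.Fin as Fin using (Fin; toℕ)
open import Data.Fin.Properties using (toℕ-injective; suc-injective; toℕ<n; toℕ-fromℕ<; any?) renaming (_≟_ to _≟ᶠ_)
open import Data.Fin.Subset using (Subset; ∣_∣; ⊤; _∉_) renaming (⊥ to ⊥ˢ)
open import Data.Fin.Subset.Properties using (∣p∣≤n; ∣⊤∣≡n)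
open import Data.Integer using (ℤ; 0ℤ; 1ℤ; -1ℤ; _+_; _*_; -_; +0; +[1+_]; -[1+_])
open import Data.Integer.Properties
  using (+-*-semiring; +-0-abelianGroup; *-assoc; *-zeroʳ; *-identityˡ; *-identityʳ; +-identityʳ; +-identityˡ;
         +-inverseʳ; *-distribˡ-+; neg-distribʳ-*; -1*i≡-i)
open import Data.Integer.Tactic.RingSolver using (solve-∀)
import Data.List as List
open import Data.Nat as ℕ using (ℕ; zero; suc; _≤_; _<_; _∸_; _/_; _<ᵇ_; s≤s; z≤n)
open import Data.Nat.Combinatorics using (_C_)
open import Data.Nat.DivMod using (m/n*n≤m)
open import Data.Nat.Properties as ℕₚ
  using (<ᵇ-reflects-<; <-asym; <-irrefl; <-cmp; ≤-antisym; ≮⇒≥; ≤-refl; ≤-trans; ≤-pred; <⇒≤; n≤1+n; n<1+n; 1+n≰n;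
         +-suc; +-comm; *-comm; *-suc; +-monoʳ-≤; *-monoʳ-≤; +-cancelˡ-≤; ∸-monoˡ-≤; m≤n+m∸n; m+[n∸m]≡n;
         [m+n]∸[m+o]≡n∸o; m≤o∸n⇒m+n≤o; m∸n≢0⇒n<m; m<1+n⇒m<n∨m≡n; module ≤-Reasoning)
open import Data.Product using (Σ-syntax; ∃; _×_; _,_; proj₁; proj₂; map₂)
open import Data.Sum using (_⊎_; inj₁; inj₂)
open import Data.Vec using ([]; _∷_; _[_]≔_; lookup)
open import Data.Vec.Properties
  using ([]≔-idempotent; []≔-commutes; []≔-lookup; lookup∘update; lookup∘update′; lookup-replicate; []=⇒lookup; lookup⇒[]=)
open import Function using (_∘_; _⇔_; mk⇔; Equivalence; case_of_)
open import Relation.Binary using (tri<; tri≈; tri>)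
open import Relation.Binary.PropositionalEquality
open import Relation.Nullary using (¬_; Dec; yes; no)
open import Relation.Nullary.Decidable using (_×-dec_; ¬?)
open import Relation.Nullary.Reflects using (ofʸ; ofⁿ)
open import Relation.Unary using (Pred; ∅; _∩_; _∪_; _⊆_)

open import Algebra.Properties.Semiring.Sum +-*-semiring using (sum; sum-cong-≗; sum-replicate-zero; ∑-distrib-+; ∑-comm; *-distribˡ-sum)
open import Algebra.Properties.Group (AbelianGroup.group +-0-abelianGroup) using (inverseˡ-unique)

sumFin≡sum : ∀ {m} (f : Fin m → ℤ) → sumFin f ≡ sum f
sumFin≡sum {zero}  f = refl
sumFin≡sum {suc m} f = cong (f Fin.zero +_) (sumFin≡sum (f ∘ Fin.suc))

sumFin-cong : ∀ {m} {f g : Fin m → ℤ} → (∀ k → f k ≡ g k) → sumFin f ≡ sumFin g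
sumFin-cong {f = f} {g} f≗g = trans (sumFin≡sum f) (trans (sum-cong-≗ f≗g) (sym (sumFin≡sum g)))

sumFin-zero : ∀ {m} (f : Fin m → ℤ) → (∀ k → f k ≡ 0ℤ) → sumFin f ≡ 0ℤ
sumFin-zero {m} f f≗0 = trans (sumFin-cong f≗0) (trans (sumFin≡sum {m} (λ _ → 0ℤ)) (sum-replicate-zero m))

sumFin-+ : ∀ {m} (f g : Fin m → ℤ) → sumFin (λ k → f k + g k) ≡ sumFin f + sumFin g
sumFin-+ f g = trans (sumFin≡sum (λ k → f k + g k)) (trans (∑-distrib-+ f g) (sym (cong₂ _+_ (sumFin≡sum f) (sumFin≡sum g))))

*-distribˡ-sumFin : ∀ {m} x (f : Fin m → ℤ) → x * sumFin f ≡ sumFin (λ k → x * f k)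
*-distribˡ-sumFin x f = trans (cong (x *_) (sumFin≡sum f)) (trans (*-distribˡ-sum x f) (sym (sumFin≡sum (λ k → x * f k))))

neg-sumFin : ∀ {m} (f : Fin m → ℤ) → - sumFin f ≡ sumFin (λ k → - f k)
neg-sumFin f = trans (sym (-1*i≡-i _)) (trans (*-distribˡ-sumFin -1ℤ f) (sumFin-cong (-1*i≡-i ∘ f)))

sumFin-comm : ∀ {m l} (a : Fin m → Fin l → ℤ) → sumFin (λ j → sumFin (a j)) ≡ sumFin (λ k → sumFin (λ j → a j k))
sumFin-comm a = begin
  sumFin (λ j → sumFin (a j))           ≡⟨ sumFin-cong (λ j → sumFin≡sum (a j)) ⟩
  sumFin (λ j → sum (a j))              ≡⟨ sumFin≡sum (λ j → sum (a j)) ⟩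
  sum (λ j → sum (a j))                 ≡⟨ ∑-comm a ⟩
  sum (λ k → sum (λ j → a j k))         ≡⟨ sym (sumFin≡sum (λ k → sum (λ j → a j k))) ⟩
  sumFin (λ k → sum (λ j → a j k))      ≡⟨ sumFin-cong (λ k → sym (sumFin≡sum (λ j → a j k))) ⟩
  sumFin (λ k → sumFin (λ j → a j k))   ∎
  where open ≡-Reasoning

x≡-x⇒x≡0 : ∀ x → x ≡ - x → x ≡ 0ℤ
x≡-x⇒x≡0 +0       _ = refl
x≡-x⇒x≡0 +[1+ n ] ()
x≡-x⇒x≡0 -[1+ n ] ()

sumFin-antisym : ∀ {m} (a : Fin m → Fin m → ℤ) → (∀ j k → a j k + a k j ≡ 0ℤ) →
  sumFin (λ j → sumFin (a j)) ≡ 0ℤ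
sumFin-antisym a cancel = x≡-x⇒x≡0 _ (begin
  sumFin (λ j → sumFin (a j))              ≡⟨ sumFin-comm a ⟩
  sumFin (λ k → sumFin (λ j → a j k))
    ≡⟨ sumFin-cong (λ k → sumFin-cong (λ j → inverseˡ-unique (a j k) (a k j) (cancel j k))) ⟩
  sumFin (λ k → sumFin (λ j → - a k j))    ≡⟨ sumFin-cong (λ k → sym (neg-sumFin (a k))) ⟩
  sumFin (λ k → - sumFin (a k))            ≡⟨ sym (neg-sumFin (λ k → sumFin (a k))) ⟩
  - sumFin (λ k → sumFin (a k))            ∎)
  where open ≡-Reasoning

sumFin-concentrated : ∀ {m} (f : Fin m → ℤ) e → (∀ k → k ≢ e → f k ≡ 0ℤ) → sumFin f ≡ f e
sumFin-concentrated {suc m} f Fin.zero f≡0 =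
  trans (cong (f Fin.zero +_) (sumFin-zero (f ∘ Fin.suc) (λ k → f≡0 (Fin.suc k) λ ()))) (+-identityʳ _)
sumFin-concentrated {suc m} f (Fin.suc e) f≡0 =
  trans (cong₂ _+_ (f≡0 Fin.zero λ ()) (sumFin-concentrated (f ∘ Fin.suc) e (λ k k≢e → f≡0 (Fin.suc k) (k≢e ∘ suc-injective))))
        (+-identityˡ _)

sumFin-cancelling : ∀ {m} (f g : Fin m → ℤ) e → (∀ k → k ≢ e → f k + g k ≡ 0ℤ) → sumFin f + sumFin g ≡ f e + g e
sumFin-cancelling f g e cancel = trans (sym (sumFin-+ f g)) (sumFin-concentrated (λ k → f k + g k) e cancel)

Present Missing : ∀ {k} → Subset k → Fin k → Set
Present S x = lookup S x ≡ true
Missing S x = lookup S x ≡ false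

true≢false : true ≢ false
true≢false ()

∉⇒Missing : ∀ {k} {S : Subset k} {y} → y ∉ S → Missing S y
∉⇒Missing {S = S} {y} y∉S with lookup S y in eq
... | true  = ⊥-elim (y∉S (lookup⇒[]= y S eq))
... | false = refl

Missing⇒∉ : ∀ {k} {S : Subset k} {y} → Missing S y → y ∉ S
Missing⇒∉ y∉S y∈S = true≢false (trans (sym ([]=⇒lookup y∈S)) y∉S)

Missing-insert : ∀ {k} (S : Subset k) {x y} → Missing (S [ x ]≔ true) y → y ≢ x × Missing S y
Missing-insert S {x} {y} y∉ with y ≟ᶠ x
... | yes refl = ⊥-elim (true≢false (trans (sym (lookup∘update x S true)) y∉))
... | no y≢x  = y≢x , trans (sym (lookup∘update′ y≢x S true)) y∉

Missing-insert⁺ : ∀ {k} (S : Subset k) {x y} → y ≢ x → Missing S y → Missing (S [ x ]≔ true) y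
Missing-insert⁺ S y≢x y∉ = trans (lookup∘update′ y≢x S true) y∉

Missing-remove : ∀ {k} (S : Subset k) {x y} → Missing (S [ x ]≔ false) y → y ≡ x ⊎ Missing S y
Missing-remove S {x} {y} y∉ with y ≟ᶠ x
... | yes y≡x = inj₁ y≡x
... | no y≢x  = inj₂ (trans (sym (lookup∘update′ y≢x S false)) y∉)

Missing-remove⁺ : ∀ {k} (S : Subset k) {x y} → Missing S y → Missing (S [ x ]≔ false) y
Missing-remove⁺ S {x} {y} y∉ with y ≟ᶠ x
... | yes refl = lookup∘update x S false
... | no y≢x  = trans (lookup∘update′ y≢x S false) y∉

Present-remove⁺ : ∀ {k} (S : Subset k) {x y} → y ≢ x → Present S y → Present (S [ x ]≔ false) y
Present-remove⁺ S y≢x y∈ = trans (lookup∘update′ y≢x S false) y∈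

size-insert : ∀ {k} (S : Subset k) x → Missing S x → ∣ S [ x ]≔ true ∣ ≡ suc ∣ S ∣
size-insert (false ∷ S) Fin.zero    refl = refl
size-insert (true  ∷ S) (Fin.suc x) x∉S  = cong suc (size-insert S x x∉S)
size-insert (false ∷ S) (Fin.suc x) x∉S  = size-insert S x x∉S

size-remove : ∀ {k} (S : Subset k) x → Present S x → suc ∣ S [ x ]≔ false ∣ ≡ ∣ S ∣
size-remove (true  ∷ S) Fin.zero    refl = refl
size-remove (true  ∷ S) (Fin.suc x) x∈S  = cong suc (size-remove S x x∈S)
size-remove (false ∷ S) (Fin.suc x) x∈S  = size-remove S x x∈S

missingCount : ∀ {k} → Subset k → ℕ
missingCount []          = 0
missingCount (false ∷ S) = suc (missingCount S)
missingCount (true  ∷ S) = missingCount S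

size+missingCount : ∀ {k} (S : Subset k) → ∣ S ∣ ℕ.+ missingCount S ≡ k
size+missingCount []          = refl
size+missingCount (true  ∷ S) = cong suc (size+missingCount S)
size+missingCount (false ∷ S) = trans (+-suc ∣ S ∣ (missingCount S)) (cong suc (size+missingCount S))

missingCount-⊥ : ∀ k → missingCount (⊥ˢ {k}) ≡ k
missingCount-⊥ zero    = refl
missingCount-⊥ (suc k) = cong suc (missingCount-⊥ k)

missingCount-insert : ∀ {k} (S : Subset k) x → missingCount S ≤ suc (missingCount (S [ x ]≔ true))
missingCount-insert (false ∷ S) Fin.zero    = ≤-refl
missingCount-insert (true  ∷ S) Fin.zero    = n≤1+n _
missingCount-insert (false ∷ S) (Fin.suc x) = s≤s (missingCount-insert S x)
missingCount-insert (true  ∷ S) (Fin.suc x) = missingCount-insert S x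

missingCount-insert₂ : ∀ {k} (S : Subset k) x y → missingCount S ≤ 2 ℕ.+ missingCount ((S [ x ]≔ true) [ y ]≔ true)
missingCount-insert₂ S x y = ≤-trans (missingCount-insert S x) (s≤s (missingCount-insert (S [ x ]≔ true) y))

some-missing : ∀ {k} (S : Subset k) → 1 ≤ missingCount S → ∃ (Missing S)
some-missing (false ∷ S) _ = Fin.zero , refl
some-missing (true  ∷ S) h with some-missing S h
... | x , x∉S = Fin.suc x , x∉S

distinct-pair : ∀ {k} → 2 ≤ k → Σ[ a ∈ Fin k ] Σ[ b ∈ Fin k ] a ≢ b
distinct-pair (s≤s (s≤s _)) = Fin.zero , Fin.suc Fin.zero , λ ()

below-suc-split : ∀ {m k} {e e′ : Fin m} → toℕ e ≡ k → toℕ e′ < suc k → toℕ e′ < k ⊎ e′ ≡ e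
below-suc-split e≡k e′<1+k with m<1+n⇒m<n∨m≡n e′<1+k
... | inj₁ e′<k = inj₁ e′<k
... | inj₂ e′≡k = inj₂ (toℕ-injective (trans e′≡k (sym e≡k)))

sign : Bool → ℤ
sign b = if b then -1ℤ else 1ℤ

sign² : ∀ b → sign b * sign b ≡ 1ℤ
sign² true  = refl
sign² false = refl

prodFin-sign² : ∀ {m} (f : Fin m → Bool) → prodFin (sign ∘ f) * prodFin (sign ∘ f) ≡ 1ℤ
prodFin-sign² {zero}  f = refl
prodFin-sign² {suc m} f = begin
  (x * y) * (x * y)  ≡⟨ regroup x y ⟩
  (x * x) * (y * y)  ≡⟨ cong₂ _*_ (sign² (f Fin.zero)) (prodFin-sign² (f ∘ Fin.suc)) ⟩
  1ℤ                 ∎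
  where
  open ≡-Reasoning
  x = sign (f Fin.zero)
  y = prodFin (sign ∘ f ∘ Fin.suc)
  regroup : ∀ a b → (a * b) * (a * b) ≡ (a * a) * (b * b)
  regroup = solve-∀

prodFin-cong : ∀ {m} {f g : Fin m → ℤ} → (∀ k → f k ≡ g k) → prodFin f ≡ prodFin g
prodFin-cong {zero}  f≗g = refl
prodFin-cong {suc m} f≗g = cong₂ _*_ (f≗g Fin.zero) (prodFin-cong (f≗g ∘ Fin.suc))

prodFin-scale-one : ∀ {m} (f g : Fin m → ℤ) e a → (∀ k → k ≢ e → f k ≡ g k) → f e ≡ a * g e →
  prodFin f ≡ a * prodFin g
prodFin-scale-one {suc m} f g Fin.zero a same at-e =
  trans (cong₂ _*_ at-e (prodFin-cong (λ k → same (Fin.suc k) λ ()))) (*-assoc a _ _)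
prodFin-scale-one {suc m} f g (Fin.suc e) a same at-e =
  trans (cong₂ _*_ (same Fin.zero λ ())
                   (prodFin-scale-one (f ∘ Fin.suc) (g ∘ Fin.suc) e a (λ k k≢e → same (Fin.suc k) (k≢e ∘ suc-injective)) at-e))
        (exchange (g Fin.zero) a _)
  where
  exchange : ∀ x a y → x * (a * y) ≡ a * (x * y)
  exchange = solve-∀

orderSign : ∀ {m} → Fin m → Fin m → ℤ
orderSign e j = sign (toℕ e <ᵇ toℕ j)

orderSign² : ∀ {m} (e j : Fin m) → orderSign e j * orderSign e j ≡ 1ℤ
orderSign² e j = sign² (toℕ e <ᵇ toℕ j)

orderSign-refl : ∀ {m} (e : Fin m) → orderSign e e ≡ 1ℤ
orderSign-refl e with toℕ e <ᵇ toℕ e | <ᵇ-reflects-< (toℕ e) (toℕ e)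
... | true  | ofʸ e<e = ⊥-elim (<-irrefl refl e<e)
... | false | _       = refl

orderSign-antisym : ∀ {m} (e j : Fin m) → e ≢ j → orderSign e j ≡ - orderSign j e
orderSign-antisym e j e≢j
  with toℕ e <ᵇ toℕ j | <ᵇ-reflects-< (toℕ e) (toℕ j) | toℕ j <ᵇ toℕ e | <ᵇ-reflects-< (toℕ j) (toℕ e)
... | true  | ofʸ e<j | true  | ofʸ j<e = ⊥-elim (<-asym e<j j<e)
... | true  | _       | false | _       = refl
... | false | _       | true  | _       = refl
... | false | ofⁿ e≮j | false | ofⁿ j≮e = ⊥-elim (e≢j (toℕ-injective (≤-antisym (≮⇒≥ j≮e) (≮⇒≥ e≮j))))

sgn² : ∀ {m} (τ : Subset m) j → sgn τ j * sgn τ j ≡ 1ℤ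
sgn² τ j = prodFin-sign² (λ k → lookup τ k ∧ (toℕ k <ᵇ toℕ j))

sgn-update : ∀ {m} (τ : Subset m) e j → sgn (τ [ e ]≔ true) j ≡ orderSign e j * sgn (τ [ e ]≔ false) j
sgn-update τ e j = prodFin-scale-one _ _ e (orderSign e j) away at-e
  where
  before : Subset _ → Fin _ → Bool
  before σ k = lookup σ k ∧ (toℕ k <ᵇ toℕ j)
  away : ∀ k → k ≢ e → sign (before (τ [ e ]≔ true) k) ≡ sign (before (τ [ e ]≔ false) k)
  away k k≢e rewrite lookup∘update′ k≢e τ true | lookup∘update′ k≢e τ false = refl
  at-e : sign (before (τ [ e ]≔ true) e) ≡ orderSign e j * sign (before (τ [ e ]≔ false) e)
  at-e rewrite lookup∘update e τ true | lookup∘update e τ false = sym (*-identityʳ _)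

update-lookup : ∀ {m} (σ : Subset m) j {b} → lookup σ j ≡ b → σ [ j ]≔ b ≡ σ
update-lookup σ j refl = []≔-lookup σ j

sgn-insert : ∀ {m} (σ : Subset m) e k → Missing σ e → sgn (σ [ e ]≔ true) k ≡ orderSign e k * sgn σ k
sgn-insert σ e k e∉σ = trans (sgn-update σ e k) (cong (λ τ → orderSign e k * sgn τ k) (update-lookup σ e e∉σ))

sgn-remove : ∀ {m} (σ : Subset m) j k → Present σ j → sgn (σ [ j ]≔ false) k ≡ orderSign j k * sgn σ k
sgn-remove σ j k j∈σ = begin
  sgn σ⁻ k                                        ≡⟨ sym (*-identityˡ _) ⟩
  1ℤ * sgn σ⁻ k                                   ≡⟨ cong (_* sgn σ⁻ k) (sym (orderSign² j k)) ⟩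
  (orderSign j k * orderSign j k) * sgn σ⁻ k      ≡⟨ *-assoc (orderSign j k) _ _ ⟩
  orderSign j k * (orderSign j k * sgn σ⁻ k)      ≡⟨ cong (orderSign j k *_) (sym (sgn-update σ j k)) ⟩
  orderSign j k * sgn (σ [ j ]≔ true) k           ≡⟨ cong (λ τ → orderSign j k * sgn τ k) (update-lookup σ j j∈σ) ⟩
  orderSign j k * sgn σ k                         ∎
  where
  open ≡-Reasoning
  σ⁻ = σ [ j ]≔ false

sgn-insert-self : ∀ {m} (σ : Subset m) e → Missing σ e → sgn (σ [ e ]≔ true) e ≡ sgn σ e
sgn-insert-self σ e e∉σ = trans (sgn-insert σ e e e∉σ) (trans (cong (_* sgn σ e) (orderSign-refl e)) (*-identityˡ _))

sgn-remove-self : ∀ {m} (σ : Subset m) e → Present σ e → sgn (σ [ e ]≔ false) e ≡ sgn σ e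
sgn-remove-self σ e e∈σ = trans (sgn-remove σ e e e∈σ) (trans (cong (_* sgn σ e) (orderSign-refl e)) (*-identityˡ _))

Cochain : ℕ → Set
Cochain m = Subset m → ℤ

Cocycle : ∀ {m} → Cochain m → Set
Cocycle f = ∀ τ → δ f τ ≡ 0ℤ

δ-term : ∀ {m} → Cochain m → Subset m → Fin m → ℤ
δ-term g τ j = if lookup τ j then sgn τ j * g (τ [ j ]≔ false) else 0ℤ

δ-cong : ∀ {m} (f g : Cochain m) τ → (∀ j → Present τ j → f (τ [ j ]≔ false) ≡ g (τ [ j ]≔ false)) →
  δ f τ ≡ δ g τ
δ-cong f g τ f≡g = sumFin-cong term-cong
  where
  term-cong : ∀ j → δ-term f τ j ≡ δ-term g τ j
  term-cong j with lookup τ j in j∈τ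
  ... | true  = cong (sgn τ j *_) (f≡g j j∈τ)
  ... | false = refl

δ-zero : ∀ {m} (f : Cochain m) τ → (∀ j → Present τ j → f (τ [ j ]≔ false) ≡ 0ℤ) → δ f τ ≡ 0ℤ
δ-zero f τ f≡0 = sumFin-zero (δ-term f τ) term-zero
  where
  term-zero : ∀ j → δ-term f τ j ≡ 0ℤ
  term-zero j with lookup τ j in j∈τ
  ... | true  = trans (cong (sgn τ j *_) (f≡0 j j∈τ)) (*-zeroʳ (sgn τ j))
  ... | false = refl

δ-+ : ∀ {m} (f g : Cochain m) τ → δ (λ σ → f σ + g σ) τ ≡ δ f τ + δ g τ
δ-+ f g τ = trans (sumFin-cong term-+) (sumFin-+ (δ-term f τ) (δ-term g τ))
  where
  term-+ : ∀ j → δ-term (λ σ → f σ + g σ) τ j ≡ δ-term f τ j + δ-term g τ j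
  term-+ j with lookup τ j
  ... | true  = *-distribˡ-+ (sgn τ j) _ _
  ... | false = refl

δ-neg : ∀ {m} (f : Cochain m) τ → δ (λ σ → - f σ) τ ≡ - δ f τ
δ-neg f τ = trans (sumFin-cong term-neg) (sym (neg-sumFin (δ-term f τ)))
  where
  term-neg : ∀ j → δ-term (λ σ → - f σ) τ j ≡ - δ-term f τ j
  term-neg j with lookup τ j
  ... | true  = sym (neg-distribʳ-* (sgn τ j) _)
  ... | false = refl

-- The two ways of removing (or inserting) a pair of vertices pick up opposite signs.
opposite-signs-cancel : ∀ {s t s′ t′ o o′ x y : ℤ} → s′ ≡ o * t → t′ ≡ o′ * s → o ≡ - o′ → x ≡ y →
  s * (s′ * x) + t * (t′ * y) ≡ 0ℤ
opposite-signs-cancel {s} {t} {o′ = o′} {x} refl refl refl refl = ring o′ s t x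
  where
  ring : ∀ o s t x → s * ((- o * t) * x) + t * ((o * s) * x) ≡ 0ℤ
  ring = solve-∀

if-*-sumFin : ∀ {m} b x (h : Fin m → ℤ) → (if b then x * sumFin h else 0ℤ) ≡ sumFin (λ k → if b then x * h k else 0ℤ)
if-*-sumFin true  x h = *-distribˡ-sumFin x h
if-*-sumFin false x h = sym (sumFin-zero (λ k → if false then x * h k else 0ℤ) (λ _ → refl))

δ∘δ≡0 : ∀ {m} (f : Cochain m) → Cocycle (δ f)
δ∘δ≡0 {m} f τ = trans (sumFin-cong expand) (sumFin-antisym a cancel)
  where
  a : Fin m → Fin m → ℤ
  a j k = if lookup τ j then sgn τ j * δ-term f (τ [ j ]≔ false) k else 0ℤ
  expand : ∀ j → δ-term (δ f) τ j ≡ sumFin (a j)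
  expand j = if-*-sumFin (lookup τ j) (sgn τ j) (δ-term f (τ [ j ]≔ false))
  cancel : ∀ j k → a j k + a k j ≡ 0ℤ
  cancel j k with j ≟ᶠ k
  cancel j .j | yes refl with lookup τ j
  ... | true  rewrite lookup∘update j τ false | *-zeroʳ (sgn τ j) = refl
  ... | false = refl
  cancel j k | no j≢k
    rewrite lookup∘update′ (j≢k ∘ sym) τ false | lookup∘update′ j≢k τ false
    with lookup τ j in j∈τ | lookup τ k in k∈τ
  ... | true  | true  = opposite-signs-cancel (sgn-remove τ j k j∈τ) (sgn-remove τ k j k∈τ)
                          (orderSign-antisym j k j≢k) (cong f ([]≔-commutes τ j k j≢k))
  ... | true  | false rewrite *-zeroʳ (sgn τ j) = refl
  ... | false | true  rewrite *-zeroʳ (sgn τ k) = refl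
  ... | false | false = refl

cone : ∀ {m} → Fin m → Cochain m → Cochain m
cone e f σ = if lookup σ e then 0ℤ else sgn σ e * f (σ [ e ]≔ true)

link : ∀ {m} → Fin m → Cochain m → Cochain m
link e φ σ = if lookup σ e then sgn σ e * φ (σ [ e ]≔ false) else 0ℤ

sgn²-cancel : ∀ {m} (σ : Subset m) e {s} x → s ≡ sgn σ e → sgn σ e * (s * x) ≡ x
sgn²-cancel σ e x refl = trans (sym (*-assoc (sgn σ e) _ x)) (trans (cong (_* x) (sgn² σ e)) (*-identityˡ x))

update-update-lookup : ∀ {m} (σ : Subset m) e b {c} → lookup σ e ≡ c → (σ [ e ]≔ b) [ e ]≔ c ≡ σ
update-update-lookup σ e b σe≡c = trans ([]≔-idempotent σ e) (update-lookup σ e σe≡c)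

cone-homotopy : ∀ {m} e (f : Cochain m) σ → δ (cone e f) σ + cone e (δ f) σ ≡ f σ
cone-homotopy e f σ with lookup σ e in e∈σ
... | true = trans (+-identityʳ _) (trans (sumFin-concentrated (δ-term (cone e f) σ) e away) at-e)
  where
  away : ∀ j → j ≢ e → δ-term (cone e f) σ j ≡ 0ℤ
  away j j≢e with lookup σ j
  ... | false = refl
  ... | true rewrite lookup∘update′ (j≢e ∘ sym) σ false | e∈σ = *-zeroʳ (sgn σ j)
  at-e : δ-term (cone e f) σ e ≡ f σ
  at-e rewrite e∈σ | lookup∘update e σ false =
    trans (sgn²-cancel σ e _ (sgn-remove-self σ e e∈σ)) (cong f (update-update-lookup σ e false e∈σ))
... | false = begin
  δ (cone e f) σ + sgn σ e * δ f σ⁺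
    ≡⟨ cong (δ (cone e f) σ +_) (*-distribˡ-sumFin (sgn σ e) (δ-term f σ⁺)) ⟩
  sumFin (δ-term (cone e f) σ) + sumFin (λ j → sgn σ e * δ-term f σ⁺ j)
    ≡⟨ sumFin-cancelling _ _ e cancel ⟩
  δ-term (cone e f) σ e + sgn σ e * δ-term f σ⁺ e
    ≡⟨ at-e ⟩
  f σ
    ∎
  where
  open ≡-Reasoning
  σ⁺ = σ [ e ]≔ true
  cancel : ∀ j → j ≢ e → δ-term (cone e f) σ j + sgn σ e * δ-term f σ⁺ j ≡ 0ℤ
  cancel j j≢e rewrite lookup∘update′ j≢e σ true | lookup∘update′ (j≢e ∘ sym) σ false with lookup σ j in j∈σ
  ... | false = trans (+-identityˡ _) (*-zeroʳ (sgn σ e))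
  ... | true rewrite e∈σ = opposite-signs-cancel (sgn-remove σ j e j∈σ) (sgn-insert σ e j e∈σ)
                             (orderSign-antisym j e j≢e) (cong f ([]≔-commutes σ j e j≢e))
  at-e : δ-term (cone e f) σ e + sgn σ e * δ-term f σ⁺ e ≡ f σ
  at-e rewrite e∈σ | lookup∘update e σ true =
    trans (+-identityˡ _) (trans (sgn²-cancel σ e _ (sgn-insert-self σ e e∈σ)) (cong f (update-update-lookup σ e true e∈σ)))

link-anticommutes : ∀ {m} e (φ : Cochain m) σ → δ (link e φ) σ + link e (δ φ) σ ≡ 0ℤ
link-anticommutes e φ σ with lookup σ e in e∈σ
... | false = trans (+-identityʳ _) (sumFin-zero (δ-term (link e φ) σ) vanish)
  where
  vanish : ∀ j → δ-term (link e φ) σ j ≡ 0ℤ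
  vanish j with j ≟ᶠ e
  ... | yes refl rewrite e∈σ = refl
  ... | no j≢e with lookup σ j
  ...   | false = refl
  ...   | true rewrite lookup∘update′ (j≢e ∘ sym) σ false | e∈σ = *-zeroʳ (sgn σ j)
... | true = begin
  δ (link e φ) σ + sgn σ e * δ φ σ⁻
    ≡⟨ cong (δ (link e φ) σ +_) (*-distribˡ-sumFin (sgn σ e) (δ-term φ σ⁻)) ⟩
  sumFin (δ-term (link e φ) σ) + sumFin (λ j → sgn σ e * δ-term φ σ⁻ j)
    ≡⟨ sumFin-cancelling _ _ e cancel ⟩
  δ-term (link e φ) σ e + sgn σ e * δ-term φ σ⁻ e
    ≡⟨ at-e ⟩
  0ℤ
    ∎
  where
  open ≡-Reasoning
  σ⁻ = σ [ e ]≔ false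
  cancel : ∀ j → j ≢ e → δ-term (link e φ) σ j + sgn σ e * δ-term φ σ⁻ j ≡ 0ℤ
  cancel j j≢e rewrite lookup∘update′ j≢e σ false | lookup∘update′ (j≢e ∘ sym) σ false | e∈σ with lookup σ j in j∈σ
  ... | false = trans (+-identityˡ _) (*-zeroʳ (sgn σ e))
  ... | true = opposite-signs-cancel (sgn-remove σ j e j∈σ) (sgn-remove σ e j e∈σ)
                 (orderSign-antisym j e j≢e) (cong φ ([]≔-commutes σ j e j≢e))
  at-e : δ-term (link e φ) σ e + sgn σ e * δ-term φ σ⁻ e ≡ 0ℤ
  at-e rewrite e∈σ | lookup∘update e σ false = cong₂ _+_ (*-zeroʳ (sgn σ e)) (*-zeroʳ (sgn σ e))

cone-link : ∀ {m} e (φ : Cochain m) σ → cone e (link e φ) σ ≡ (if lookup σ e then 0ℤ else φ σ)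
cone-link e φ σ with lookup σ e in e∈σ
... | true  = refl
... | false rewrite lookup∘update e σ true =
  trans (sgn²-cancel σ e _ (sgn-insert-self σ e e∈σ)) (cong φ (update-update-lookup σ e true e∈σ))

link-zero : ∀ {m} e (φ : Cochain m) σ → (∀ τ → φ τ ≡ 0ℤ) → link e φ σ ≡ 0ℤ
link-zero e φ σ φ≡0 with lookup σ e
... | true  = trans (cong (sgn σ e *_) (φ≡0 _)) (*-zeroʳ (sgn σ e))
... | false = refl

cone-zero : ∀ {m} e (f : Cochain m) σ → (∀ τ → f τ ≡ 0ℤ) → cone e f σ ≡ 0ℤ
cone-zero e f σ f≡0 with lookup σ e
... | true  = refl
... | false = trans (cong (sgn σ e *_) (f≡0 _)) (*-zeroʳ (sgn σ e))

cone-cong : ∀ {m} e (f g : Cochain m) σ → (∀ τ → f τ ≡ g τ) → cone e f σ ≡ cone e g σ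
cone-cong e f g σ f≡g with lookup σ e
... | true  = refl
... | false = cong (sgn σ e *_) (f≡g _)

link-cocycle : ∀ {m} e (φ : Cochain m) → Cocycle φ → Cocycle (link e φ)
link-cocycle e φ dφ≡0 σ =
  trans (sym (+-identityʳ _)) (trans (cong (δ (link e φ) σ +_) (sym (link-zero e (δ φ) σ dφ≡0))) (link-anticommutes e φ σ))

cocycle-coboundary : ∀ {m} e (f : Cochain m) → Cocycle f → ∀ σ → f σ ≡ δ (cone e f) σ
cocycle-coboundary e f df≡0 σ =
  trans (sym (cone-homotopy e f σ)) (trans (cong (δ (cone e f) σ +_) (cone-zero e (δ f) σ df≡0)) (+-identityʳ _))

-- Simplices are edge sets of a graph on [n] whose edges are labelled by Fin M and join every pair of
-- vertices; a vertex set A collects the vertices that the missing edges of a simplex must avoid.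
module MatchingComplex {n M : ℕ} (ends : Fin M → Fin n × Fin n)
  (covers : ∀ a b → a ≢ b → ∃ λ e → ends e ≡ (a , b) ⊎ ends e ≡ (b , a)) where

  Touches : Fin M → Fin n → Set
  Touches e w = proj₁ (ends e) ≡ w ⊎ proj₂ (ends e) ≡ w

  touches? : ∀ e w → Dec (Touches e w)
  touches? e w with proj₁ (ends e) ≟ᶠ w | proj₂ (ends e) ≟ᶠ w
  ... | yes a≡w | _       = yes (inj₁ a≡w)
  ... | no _    | yes b≡w = yes (inj₂ b≡w)
  ... | no a≢w  | no b≢w  = no λ { (inj₁ a≡w) → a≢w a≡w ; (inj₂ b≡w) → b≢w b≡w }

  FreeEnds : Subset n → Fin M → Set
  FreeEnds A e = Missing A (proj₁ (ends e)) × Missing A (proj₂ (ends e))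

  withEnds : Subset n → Fin M → Subset n
  withEnds A e = (A [ proj₁ (ends e) ]≔ true) [ proj₂ (ends e) ]≔ true

  Missing-withEnds : ∀ A e {w} → Missing (withEnds A e) w → Missing A w × ¬ Touches e w
  Missing-withEnds A e w∉ with Missing-insert (A [ proj₁ (ends e) ]≔ true) w∉
  ... | w≢b , w∉₁ with Missing-insert A w∉₁
  ...   | w≢a , w∉A = w∉A , λ { (inj₁ a≡w) → w≢a (sym a≡w) ; (inj₂ b≡w) → w≢b (sym b≡w) }

  Missing-withEnds⁺ : ∀ A e {w} → Missing A w → ¬ Touches e w → Missing (withEnds A e) w
  Missing-withEnds⁺ A e w∉A untouched =
    Missing-insert⁺ (A [ proj₁ (ends e) ]≔ true) (untouched ∘ inj₂ ∘ sym) (Missing-insert⁺ A (untouched ∘ inj₁ ∘ sym) w∉A)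

  _⊑_ : Subset n → Subset n → Set
  A ⊑ A′ = ∀ {w} → Missing A′ w → Missing A w

  ⊑-withEnds : ∀ A e → A ⊑ withEnds A e
  ⊑-withEnds A e = proj₁ ∘ Missing-withEnds A e

  ⊑-insert : ∀ A x → A ⊑ (A [ x ]≔ true)
  ⊑-insert A x = proj₂ ∘ Missing-insert A

  record CoMatching (A : Subset n) (c : ℕ) (σ : Subset M) : Set where
    field
      size     : ∣ σ ∣ ℕ.+ c ≡ M
      disjoint : ∀ {e e′ w} → Missing σ e → Missing σ e′ → e ≢ e′ → Touches e w → Touches e′ w → ⊥
      avoids   : ∀ {e w} → Missing σ e → Touches e w → Missing A w

  open CoMatching

  CoMatching-antitone : ∀ {A A′ c} → A ⊑ A′ → CoMatching A′ c ⊆ CoMatching A c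
  CoMatching-antitone A⊑A′ p = record { size = size p ; disjoint = disjoint p ; avoids = λ e∉ t → A⊑A′ (avoids p e∉ t) }

  CoMatching-fill : ∀ {A c σ} e → Present σ e → CoMatching A (suc c) (σ [ e ]≔ false) → CoMatching (withEnds A e) c σ
  CoMatching-fill {A} {c} {σ} e e∈σ p = record
    { size     = trans (cong (ℕ._+ c) (sym (size-remove σ e e∈σ))) (trans (sym (+-suc _ c)) (size p))
    ; disjoint = λ e₁∉ e₂∉ → disjoint p (Missing-remove⁺ σ e₁∉) (Missing-remove⁺ σ e₂∉)
    ; avoids   = λ e₁∉ t → Missing-withEnds⁺ A e (avoids p (Missing-remove⁺ σ e₁∉) t)
                             (disjoint p (Missing-remove⁺ σ e₁∉) (lookup∘update e σ false) (≢-present e₁∉) t)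
    }
    where
    ≢-present : ∀ {e₁} → Missing σ e₁ → e₁ ≢ e
    ≢-present e₁∉ refl = true≢false (trans (sym e∈σ) e₁∉)

  CoMatching-open : ∀ {A c σ} e → FreeEnds A e → Missing σ e → CoMatching (withEnds A e) c (σ [ e ]≔ true) → CoMatching A (suc c) σ
  CoMatching-open {A} {c} {σ} e (a∉A , b∉A) e∉σ p = record
    { size     = trans (+-suc ∣ σ ∣ c) (trans (cong (ℕ._+ c) (sym (size-insert σ e e∉σ))) (size p))
    ; disjoint = disjoint′
    ; avoids   = avoids′
    }
    where
    unseen : ∀ {e₁ w} → Missing σ e₁ → e₁ ≢ e → Touches e₁ w → Missing (withEnds A e) w
    unseen e₁∉ e₁≢e = avoids p (Missing-insert⁺ σ e₁≢e e₁∉)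
    disjoint′ : ∀ {e₁ e₂ w} → Missing σ e₁ → Missing σ e₂ → e₁ ≢ e₂ → Touches e₁ w → Touches e₂ w → ⊥
    disjoint′ {e₁} {e₂} e₁∉ e₂∉ e₁≢e₂ t₁ t₂ with e₁ ≟ᶠ e | e₂ ≟ᶠ e
    ... | yes refl | yes refl = e₁≢e₂ refl
    ... | yes refl | no e₂≢e  = proj₂ (Missing-withEnds A e (unseen e₂∉ e₂≢e t₂)) t₁
    ... | no e₁≢e  | yes refl = proj₂ (Missing-withEnds A e (unseen e₁∉ e₁≢e t₁)) t₂
    ... | no e₁≢e  | no e₂≢e  = disjoint p (Missing-insert⁺ σ e₁≢e e₁∉) (Missing-insert⁺ σ e₂≢e e₂∉) e₁≢e₂ t₁ t₂
    avoids′ : ∀ {e₁ w} → Missing σ e₁ → Touches e₁ w → Missing A w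
    avoids′ {e₁} e₁∉ t with e₁ ≟ᶠ e | t
    ... | yes refl | inj₁ refl = a∉A
    ... | yes refl | inj₂ refl = b∉A
    ... | no e₁≢e  | _         = ⊑-withEnds A e (unseen e₁∉ e₁≢e t)

  SupportedOn : Pred (Subset M) _ → Cochain M → Set
  SupportedOn Q φ = ∀ σ → ¬ Q σ → φ σ ≡ 0ℤ

  SupportedOn-mono : ∀ {Q Q′ : Pred (Subset M) _} {φ} → Q ⊆ Q′ → SupportedOn Q φ → SupportedOn Q′ φ
  SupportedOn-mono Q⊆Q′ supp σ ¬Q′ = supp σ (¬Q′ ∘ Q⊆Q′)

  link-supported : ∀ {A c φ} e →
    SupportedOn (CoMatching A (suc c)) φ → SupportedOn (CoMatching (withEnds A e) c) (link e φ)
  link-supported e supp σ ¬p with lookup σ e in e∈σ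
  ... | false = refl
  ... | true  = trans (cong (sgn σ e *_) (supp _ (¬p ∘ CoMatching-fill e e∈σ))) (*-zeroʳ (sgn σ e))

  cone-supported : ∀ {A c ω} e → FreeEnds A e →
    SupportedOn (CoMatching (withEnds A e) c) ω → SupportedOn (CoMatching A (suc c)) (cone e ω)
  cone-supported e free supp σ ¬p with lookup σ e in e∉σ
  ... | true  = refl
  ... | false = trans (cong (sgn σ e *_) (supp _ (¬p ∘ CoMatching-open e free e∉σ))) (*-zeroʳ (sgn σ e))

  record Reduction (A : Subset n) (c : ℕ) (Q : Pred (Subset M) _) (φ : Cochain M) : Set where
    field
      residue         : Cochain M
      residue-supp    : SupportedOn Q residue
      residue-cocycle : Cocycle residue
      potential       : Cochain M
      potential-supp  : SupportedOn (CoMatching A (suc c)) potential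
      decomposition   : ∀ σ → φ σ ≡ residue σ + δ potential σ

  Reducible : Subset n → ℕ → (Q Q′ : Pred (Subset M) _) → Set
  Reducible A c Q Q′ = ∀ φ → SupportedOn Q φ → Cocycle φ → Reduction A c Q′ φ

  reducible-refl : ∀ {A c Q Q′} → Q ⊆ Q′ → Reducible A c Q Q′
  reducible-refl Q⊆Q′ φ supp cocycle = record
    { residue         = φ
    ; residue-supp    = SupportedOn-mono Q⊆Q′ supp
    ; residue-cocycle = cocycle
    ; potential       = λ _ → 0ℤ
    ; potential-supp  = λ _ _ → refl
    ; decomposition   = λ σ → sym (trans (cong (φ σ +_) (δ-zero (λ _ → 0ℤ) σ (λ _ _ → refl))) (+-identityʳ (φ σ)))
    }

  reducible-trans : ∀ {A c Q Q′ Q″} → Reducible A c Q Q′ → Reducible A c Q′ Q″ → Reducible A c Q Q″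
  reducible-trans first second φ supp cocycle = record
    { residue         = residue r₂
    ; residue-supp    = residue-supp r₂
    ; residue-cocycle = residue-cocycle r₂
    ; potential       = λ σ → potential r₁ σ + potential r₂ σ
    ; potential-supp  = λ σ ¬p → cong₂ _+_ (potential-supp r₁ σ ¬p) (potential-supp r₂ σ ¬p)
    ; decomposition   = λ σ → begin
        φ σ                                                          ≡⟨ decomposition r₁ σ ⟩
        residue r₁ σ + δ (potential r₁) σ                            ≡⟨ cong (_+ δ (potential r₁) σ) (decomposition r₂ σ) ⟩
        (residue r₂ σ + δ (potential r₂) σ) + δ (potential r₁) σ     ≡⟨ regroup (residue r₂ σ) _ _ ⟩
        residue r₂ σ + (δ (potential r₁) σ + δ (potential r₂) σ)     ≡⟨ cong (residue r₂ σ +_) (sym (δ-+ (potential r₁) (potential r₂) σ)) ⟩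
        residue r₂ σ + δ (λ τ → potential r₁ τ + potential r₂ τ) σ  ∎
    }
    where
    open Reduction
    open ≡-Reasoning
    r₁ = first φ supp cocycle
    r₂ = second (residue r₁) (residue-supp r₁) (residue-cocycle r₁)
    regroup : ∀ x y z → (x + y) + z ≡ x + (z + y)
    regroup = solve-∀

  reducible-antitone : ∀ {A A′ c Q Q′} → A ⊑ A′ → Reducible A′ c Q Q′ → Reducible A c Q Q′
  reducible-antitone A⊑A′ red φ supp cocycle = record
    { residue         = residue r
    ; residue-supp    = residue-supp r
    ; residue-cocycle = residue-cocycle r
    ; potential       = potential r
    ; potential-supp  = SupportedOn-mono (CoMatching-antitone A⊑A′) (potential-supp r)
    ; decomposition   = decomposition r
    }
    where
    open Reduction
    r = red φ supp cocycle

  coboundary-of-reduction : ∀ {A c φ} (r : Reduction A c ∅ φ) → ∀ σ → φ σ ≡ δ (Reduction.potential r) σ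
  coboundary-of-reduction r σ =
    trans (Reduction.decomposition r σ) (trans (cong (_+ _) (Reduction.residue-supp r σ (λ ()))) (+-identityˡ _))

  cone-off : ∀ {A c} e → FreeEnds A e → Reducible A c (CoMatching (withEnds A e) c) ∅
  cone-off e free φ supp cocycle = record
    { residue         = λ _ → 0ℤ
    ; residue-supp    = λ _ _ → refl
    ; residue-cocycle = λ σ → δ-zero (λ _ → 0ℤ) σ (λ _ _ → refl)
    ; potential       = cone e φ
    ; potential-supp  = cone-supported e free supp
    ; decomposition   = λ σ → trans (cocycle-coboundary e φ cocycle σ) (sym (+-identityˡ _))
    }

  -- Adding δ (cone e ω) with δω = link e φ keeps φ on simplices containing e and replaces it by ω elsewhere.
  clear-edge : ∀ {A c R} e → FreeEnds A e → Reducible (withEnds A e) c (CoMatching (withEnds A e) c) ∅ →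
    R ⊆ CoMatching A (suc c) → Reducible A (suc c) R ((R ∩ (λ σ → Present σ e)) ∪ CoMatching (withEnds A e) (suc c))
  clear-edge {A} {c} {R} e free solve R⊆ φ supp cocycle = record
    { residue         = φ′
    ; residue-supp    = φ′-supp
    ; residue-cocycle = λ σ → trans (δ-+ φ (δ (cone e ω)) σ) (cong₂ _+_ (cocycle σ) (δ∘δ≡0 (cone e ω) σ))
    ; potential       = λ σ → - cone e ω σ
    ; potential-supp  = λ σ ¬p → cong -_ (cone-supported e free (potential-supp r) σ ¬p)
    ; decomposition   = λ σ → sym (trans (cong (φ′ σ +_) (δ-neg (cone e ω) σ)) (cancel (φ σ) (δ (cone e ω) σ)))
    }
    where
    open Reduction
    r = solve (link e φ) (link-supported e (SupportedOn-mono R⊆ supp)) (link-cocycle e φ cocycle)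
    ω = potential r
    φ′ : Cochain M
    φ′ σ = φ σ + δ (cone e ω) σ
    cancel : ∀ x y → (x + y) + - y ≡ x
    cancel = solve-∀
    absorb : ∀ b {x y z w} → y + z ≡ w → z ≡ (if b then 0ℤ else x) → x + y ≡ (if b then x else 0ℤ) + w
    absorb true  {x} {y} refl refl = cong (x +_) (sym (+-identityʳ y))
    absorb false {x} {y} refl refl = swap x y
      where
      swap : ∀ x y → x + y ≡ 0ℤ + (y + x)
      swap = solve-∀
    φ′-formula : ∀ σ → φ′ σ ≡ (if lookup σ e then φ σ else 0ℤ) + ω σ
    φ′-formula σ = absorb (lookup σ e) (cone-homotopy e ω σ)
      (trans (cone-cong e (δ ω) (link e φ) σ (sym ∘ coboundary-of-reduction r)) (cone-link e φ σ))
    φ′-supp : SupportedOn ((R ∩ (λ σ → Present σ e)) ∪ CoMatching (withEnds A e) (suc c)) φ′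
    φ′-supp σ ¬p = trans (φ′-formula σ) (cong₂ _+_ (kept (lookup σ e) refl) (potential-supp r σ (¬p ∘ inj₂)))
      where
      kept : ∀ b → lookup σ e ≡ b → (if b then φ σ else 0ℤ) ≡ 0ℤ
      kept true  e∈σ = supp σ (λ Rσ → ¬p (inj₁ (Rσ , e∈σ)))
      kept false _   = refl

  module _ {A : Subset n} {c : ℕ} (x : Fin n) where

    ClearedBelow : ℕ → Pred (Subset M) _
    ClearedBelow k σ = CoMatching A (suc c) σ × (∀ e → toℕ e < k → Missing σ e → ¬ Touches e x)

    ClearedBelow-skip : ∀ {k} e → toℕ e ≡ k → ¬ (Touches e x × FreeEnds A e) → ClearedBelow k ⊆ ClearedBelow (suc k)
    ClearedBelow-skip e e≡k skip (p , cleared) = p , λ e′ lt e′∉ t → case below-suc-split e≡k lt of λ where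
      (inj₁ lt′) → cleared e′ lt′ e′∉ t
      (inj₂ refl) → skip (t , avoids p e′∉ (inj₁ refl) , avoids p e′∉ (inj₂ refl))

    ClearedBelow-step : ∀ {k} e → toℕ e ≡ k → Touches e x →
      (ClearedBelow k ∩ (λ σ → Present σ e)) ∪ CoMatching (withEnds A e) (suc c) ⊆ ClearedBelow (suc k)
    ClearedBelow-step e e≡k tx (inj₁ ((p , cleared) , e∈σ)) = p , λ e′ lt e′∉ t → case below-suc-split e≡k lt of λ where
      (inj₁ lt′) → cleared e′ lt′ e′∉ t
      (inj₂ refl) → true≢false (trans (sym e∈σ) e′∉)
    ClearedBelow-step e e≡k tx (inj₂ q) =
      CoMatching-antitone (⊑-withEnds A e) q , λ e′ _ e′∉ t → proj₂ (Missing-withEnds A e (avoids q e′∉ t)) tx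

    ClearedBelow-all : ClearedBelow M ⊆ CoMatching (A [ x ]≔ true) (suc c)
    ClearedBelow-all (p , cleared) = record
      { size = size p ; disjoint = disjoint p
      ; avoids = λ {e} {w} e∉ t → Missing-insert⁺ A (λ { refl → cleared e (toℕ<n e) e∉ t }) (avoids p e∉ t) }

  clear-vertex : ∀ {A c} x → (∀ e → FreeEnds A e → Reducible (withEnds A e) c (CoMatching (withEnds A e) c) ∅) →
    Reducible A (suc c) (CoMatching A (suc c)) (CoMatching (A [ x ]≔ true) (suc c))
  clear-vertex {A} {c} x solve = reducible-trans (clear-below M ≤-refl) (reducible-refl (ClearedBelow-all x))
    where
    clear-below : ∀ k → k ≤ M → Reducible A (suc c) (CoMatching A (suc c)) (ClearedBelow x k)
    clear-below zero    _    = reducible-refl (λ p → p , λ _ ())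
    clear-below (suc k) k<M = reducible-trans (clear-below k (<⇒≤ k<M)) clear-kth
      where
      e = Fin.fromℕ< k<M
      clear-kth : Reducible A (suc c) (ClearedBelow x k) (ClearedBelow x (suc k))
      clear-kth with touches? e x ×-dec (lookup A (proj₁ (ends e)) ≟ᵇ false) ×-dec (lookup A (proj₂ (ends e)) ≟ᵇ false)
      ... | no skip = reducible-refl (ClearedBelow-skip x e (toℕ-fromℕ< k<M) skip)
      ... | yes (tx , free) = reducible-trans (clear-edge e free (solve e free) proj₁)
                                              (reducible-refl (ClearedBelow-step x e (toℕ-fromℕ< k<M) tx))

  ⊑-between : ∀ A {v x} e → (∀ {w} → Touches e w → w ≡ v ⊎ w ≡ x) → withEnds A e ⊑ ((A [ v ]≔ true) [ x ]≔ true)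
  ⊑-between A {v} {x} e ends-vx w∉ with Missing-insert (A [ v ]≔ true) w∉
  ... | w≢x , w∉₁ with Missing-insert A w∉₁
  ...   | w≢v , w∉A = Missing-withEnds⁺ A e w∉A λ t → case ends-vx t of λ where
    (inj₁ w≡v) → w≢v w≡v
    (inj₂ w≡x) → w≢x w≡x

  edge-between : ∀ {A v x} → Missing A v → Missing A x → v ≢ x →
    Σ[ e ∈ Fin M ] FreeEnds A e × (∀ {w} → Touches e w → w ≡ v ⊎ w ≡ x)
  edge-between {A} v∉A x∉A v≢x with covers _ _ v≢x
  ... | e , inj₁ e≡vx = e , (subst (Missing A) (sym a≡v) v∉A , subst (Missing A) (sym b≡x) x∉A) , λ where
          (inj₁ a≡w) → inj₁ (trans (sym a≡w) a≡v)
          (inj₂ b≡w) → inj₂ (trans (sym b≡w) b≡x)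
    where a≡v = cong proj₁ e≡vx; b≡x = cong proj₂ e≡vx
  ... | e , inj₂ e≡xv = e , (subst (Missing A) (sym a≡x) x∉A , subst (Missing A) (sym b≡v) v∉A) , λ where
          (inj₁ a≡w) → inj₂ (trans (sym a≡w) a≡x)
          (inj₂ b≡w) → inj₁ (trans (sym b≡w) b≡v)
    where a≡x = cong proj₁ e≡xv; b≡v = cong proj₂ e≡xv

  cone-off-pair : ∀ {A c v x} → Missing A v → Missing (A [ v ]≔ true) x →
    Reducible A c (CoMatching ((A [ v ]≔ true) [ x ]≔ true) c) ∅
  cone-off-pair {A} v∉A x∉A₁ with Missing-insert A x∉A₁
  ... | x≢v , x∉A with edge-between {A} v∉A x∉A (x≢v ∘ sym)
  ...   | e , free , ends-vx =
    reducible-trans (reducible-refl (CoMatching-antitone (⊑-between A e ends-vx))) (cone-off e free)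

  CoMatching-zero : ∀ {A A′} → CoMatching A 0 ⊆ CoMatching A′ 0
  CoMatching-zero {x = σ} p = record
    { size = size p ; disjoint = disjoint p ; avoids = λ {e} e∉ _ → ⊥-elim (1+n≰n (full e e∉)) }
    where
    full : ∀ e → Missing σ e → suc ∣ σ ∣ ≤ ∣ σ ∣
    full e e∉ = subst (suc ∣ σ ∣ ≤_) (trans (sym (size p)) (ℕₚ.+-identityʳ ∣ σ ∣))
                  (subst (_≤ M) (size-insert σ e e∉) (∣p∣≤n (σ [ e ]≔ true)))

  matching-reducible : ∀ c {A} → 2 ℕ.+ 3 ℕ.* c ≤ missingCount A → Reducible A c (CoMatching A c) ∅
  matching-reducible c {A} bound with some-missing A (≤-trans (s≤s z≤n) bound)
  ... | v , v∉A with some-missing (A [ v ]≔ true) (≤-trans (s≤s z≤n) (≤-pred (≤-trans bound (missingCount-insert A v))))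
  ...   | x , x∉A₁ = reduce c bound
    where
    reduce : ∀ c → 2 ℕ.+ 3 ℕ.* c ≤ missingCount A → Reducible A c (CoMatching A c) ∅
    reduce zero    _     = reducible-trans (reducible-refl CoMatching-zero) (cone-off-pair v∉A x∉A₁)
    reduce (suc c) bound =
      reducible-trans (clear-vertex v (sub A (≤-trans (n≤1+n _) bound′)))
        (reducible-trans (reducible-antitone (⊑-insert A v) (clear-vertex x (sub (A [ v ]≔ true) A₁-bound)))
          (cone-off-pair v∉A x∉A₁))
      where
      bound′ : 5 ℕ.+ 3 ℕ.* c ≤ missingCount A
      bound′ = subst (λ k → 2 ℕ.+ k ≤ missingCount A) (*-suc 3 c) bound
      A₁-bound : 4 ℕ.+ 3 ℕ.* c ≤ missingCount (A [ v ]≔ true)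
      A₁-bound = ≤-pred (≤-trans bound′ (missingCount-insert A v))
      sub : ∀ A′ → 4 ℕ.+ 3 ℕ.* c ≤ missingCount A′ →
        ∀ e → FreeEnds A′ e → Reducible (withEnds A′ e) c (CoMatching (withEnds A′ e) c) ∅
      sub A′ bound e _ = matching-reducible c (≤-pred (≤-pred (≤-trans bound (missingCount-insert₂ A′ _ _))))

  CoEdgesMeet : Subset M → Set
  CoEdgesMeet σ = Σ[ e ∈ Fin M ] Σ[ e′ ∈ Fin M ] Σ[ w ∈ Fin n ]
    Missing σ e × Missing σ e′ × e ≢ e′ × Touches e w × Touches e′ w

  coEdgesMeet? : ∀ σ → Dec (CoEdgesMeet σ)
  coEdgesMeet? σ = any? λ e → any? λ e′ → any? λ w →
    (lookup σ e ≟ᵇ false) ×-dec (lookup σ e′ ≟ᵇ false) ×-dec ¬? (e ≟ᶠ e′) ×-dec touches? e w ×-dec touches? e′ w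

  CoEdgesMeet-remove : ∀ {σ} j → CoEdgesMeet σ → CoEdgesMeet (σ [ j ]≔ false)
  CoEdgesMeet-remove {σ} j (e , e′ , w , e∉ , e′∉ , e≢e′ , t , t′) =
    e , e′ , w , Missing-remove⁺ σ e∉ , Missing-remove⁺ σ e′∉ , e≢e′ , t , t′

  CoEdgesMeet⇒¬CoMatching : ∀ {A c σ} → CoEdgesMeet σ → ¬ CoMatching A c σ
  CoEdgesMeet⇒¬CoMatching (_ , _ , _ , e∉ , e′∉ , e≢e′ , t , t′) p = disjoint p e∉ e′∉ e≢e′ t t′

  ¬CoEdgesMeet⇒CoMatching : ∀ {σ} → ¬ CoEdgesMeet σ → CoMatching ⊥ˢ (M ∸ ∣ σ ∣) σ
  ¬CoEdgesMeet⇒CoMatching {σ} ¬meet = record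
    { size     = m+[n∸m]≡n (∣p∣≤n σ)
    ; disjoint = λ e∉ e′∉ e≢e′ t t′ → ¬meet (_ , _ , _ , e∉ , e′∉ , e≢e′ , t , t′)
    ; avoids   = λ {_} {w} _ _ → lookup-replicate w false
    }

  module ExtensionByZero (i : ℕ) (f : Cochain M) where

    InDegree : Subset M → Set
    InDegree σ = CoEdgesMeet σ × ∣ σ ∣ ≡ suc i

    extension : Cochain M
    extension σ with coEdgesMeet? σ ×-dec (∣ σ ∣ ℕ.≟ suc i)
    ... | yes _ = f σ
    ... | no  _ = 0ℤ

    extension-in : ∀ {σ} → InDegree σ → extension σ ≡ f σ
    extension-in {σ} p with coEdgesMeet? σ ×-dec (∣ σ ∣ ℕ.≟ suc i)
    ... | yes _ = refl
    ... | no ¬p = ⊥-elim (¬p p)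

    extension-out : ∀ {σ} → ¬ InDegree σ → extension σ ≡ 0ℤ
    extension-out {σ} ¬p with coEdgesMeet? σ ×-dec (∣ σ ∣ ℕ.≟ suc i)
    ... | yes p = ⊥-elim (¬p p)
    ... | no _  = refl

    δ-extension-supported : (∀ τ → CoEdgesMeet τ → ∣ τ ∣ ≡ suc (suc i) → δ f τ ≡ 0ℤ) →
      SupportedOn (CoMatching ⊥ˢ (M ∸ suc (suc i))) (δ extension)
    δ-extension-supported closed τ ¬p with ∣ τ ∣ ℕ.≟ suc (suc i)
    ... | no size≢ = δ-zero extension τ λ j j∈τ →
          extension-out λ (_ , size≡) → size≢ (trans (sym (size-remove τ j j∈τ)) (cong suc size≡))
    ... | yes size≡ with coEdgesMeet? τ
    ...   | yes meet = trans (δ-cong extension f τ λ j j∈τ →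
                               extension-in (CoEdgesMeet-remove {τ} j meet , ℕₚ.suc-injective (trans (size-remove τ j j∈τ) size≡)))
                             (closed τ meet size≡)
    ...   | no ¬meet = ⊥-elim (¬p (subst (λ k → CoMatching ⊥ˢ (M ∸ k) τ) size≡ (¬CoEdgesMeet⇒CoMatching ¬meet)))

  co-edges-meet-cohomology-vanishes : ∀ i → 2 ℕ.+ 3 ℕ.* (M ∸ suc (suc i)) ≤ n → ReducedCohomVanishes M CoEdgesMeet i
  co-edges-meet-cohomology-vanishes i bound f closed = cone e₀ h , f≡δg
    where
    open ExtensionByZero i f
    r = matching-reducible (M ∸ suc (suc i)) (subst (2 ℕ.+ 3 ℕ.* (M ∸ suc (suc i)) ≤_) (sym (missingCount-⊥ n)) bound)
          (δ extension) (δ-extension-supported closed) (δ∘δ≡0 extension)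
    ψ = Reduction.potential r
    h : Cochain M
    h σ = extension σ + - ψ σ
    h-cocycle : Cocycle h
    h-cocycle σ = begin
      δ h σ                        ≡⟨ δ-+ extension (λ τ → - ψ τ) σ ⟩
      δ extension σ + δ (-_ ∘ ψ) σ ≡⟨ cong₂ _+_ (coboundary-of-reduction r σ) (δ-neg ψ σ) ⟩
      δ ψ σ + - δ ψ σ              ≡⟨ +-inverseʳ (δ ψ σ) ⟩
      0ℤ                           ∎
      where open ≡-Reasoning
    e₀ : Fin M
    e₀ with distinct-pair (≤-trans (s≤s (s≤s z≤n)) bound)
    ... | a , b , a≢b = proj₁ (covers a b a≢b)
    f≡δg : ∀ σ → CoEdgesMeet σ → ∣ σ ∣ ≡ suc i → f σ ≡ δ (cone e₀ h) σ
    f≡δg σ meet size≡ = begin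
      f σ                 ≡⟨ sym (extension-in (meet , size≡)) ⟩
      extension σ         ≡⟨ sym (+-identityʳ (extension σ)) ⟩
      extension σ + - 0ℤ  ≡⟨ cong (λ x → extension σ + - x) (sym (Reduction.potential-supp r σ (CoEdgesMeet⇒¬CoMatching meet))) ⟩
      h σ                 ≡⟨ cocycle-coboundary e₀ h h-cocycle σ ⟩
      δ (cone e₀ h) σ     ∎
      where open ≡-Reasoning

module CompleteGraphEdges where

  open import Data.List using (List; []; _∷_; concatMap; tabulate; allFin; length)
  open import Data.List.Properties using (length-++)
  open import Data.List.Membership.Propositional using (_∈_)
  open import Data.List.Membership.Propositional.Properties using (∈-lookup; ∈-concatMap⁺; ∈-concatMap⁻)
  open import Data.List.Relation.Binary.Disjoint.Propositional using (Disjoint)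
  open import Data.List.Relation.Unary.Any using (here; index)
  import Data.List.Relation.Unary.Any.Properties as Any
  import Data.List.Relation.Unary.All as All
  import Data.List.Relation.Unary.All.Properties as All
  import Data.List.Relation.Unary.AllPairs.Properties as AllPairs
  open import Data.List.Relation.Unary.AllPairs using ([]; _∷_)
  open import Data.List.Relation.Unary.All using () renaming ([] to []ᴬ)
  open import Data.List.Relation.Unary.Unique.Propositional using (Unique)
  open import Data.List.Relation.Unary.Unique.Propositional.Properties using (concat⁺)
  open import Data.Nat.Combinatorics using (nCk+nC[k+1]≡[n+1]C[k+1]; nC1≡n)
  open import Data.Nat.Properties using (+-assoc)
  import Algebra.Properties.Semiring.Sum ℕₚ.+-*-semiring as ℕΣ

  module _ {X : Set} where

    Unique-concatMap-allFin : ∀ {k} (F : Fin k → List X) (κ : X → Fin k) →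
      (∀ i {v} → v ∈ F i → κ v ≡ i) → (∀ i → Unique (F i)) → Unique (concatMap F (allFin k))
    Unique-concatMap-allFin F κ κ-F F-unique =
      concat⁺ (All.map⁺ (All.tabulate⁺ F-unique)) (AllPairs.map⁺ (AllPairs.tabulate⁺ disjoint))
      where
      disjoint : ∀ {i j} → i ≢ j → Disjoint (F i) (F j)
      disjoint i≢j (v∈Fi , v∈Fj) = i≢j (trans (sym (κ-F _ v∈Fi)) (κ-F _ v∈Fj))

    length-concatMap-tabulate : ∀ {Y : Set} {k} (F : Y → List X) (t : Fin k → Y) →
      length (concatMap F (tabulate t)) ≡ ℕΣ.sum (length ∘ F ∘ t)
    length-concatMap-tabulate {k = zero}  F t = refl
    length-concatMap-tabulate {k = suc k} F t =
      trans (length-++ (F (t Fin.zero))) (cong (length (F (t Fin.zero)) ℕ.+_) (length-concatMap-tabulate F (t ∘ Fin.suc)))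

    ∈-concatMap-allFin⁻ : ∀ {k} (F : Fin k → List X) {v} → v ∈ concatMap F (allFin k) → ∃ λ i → v ∈ F i
    ∈-concatMap-allFin⁻ F = Any.tabulate⁻ ∘ ∈-concatMap⁻ F

    ∈-concatMap-allFin⁺ : ∀ {k} (F : Fin k → List X) {v} i → v ∈ F i → v ∈ concatMap F (allFin k)
    ∈-concatMap-allFin⁺ F i = ∈-concatMap⁺ F ∘ Any.tabulate⁺ i

    lookup-injective : ∀ {xs : List X} → Unique xs → ∀ i j → List.lookup xs i ≡ List.lookup xs j → i ≡ j
    lookup-injective {_ ∷ _} u          Fin.zero    Fin.zero    _  = refl
    lookup-injective {_ ∷ _} (x∉xs ∷ _) Fin.zero    (Fin.suc j) eq = ⊥-elim (All.lookup x∉xs (∈-lookup j) eq)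
    lookup-injective {_ ∷ _} (x∉xs ∷ _) (Fin.suc i) Fin.zero    eq = ⊥-elim (All.lookup x∉xs (∈-lookup i) (sym eq))
    lookup-injective {_ ∷ _} (_ ∷ u)    (Fin.suc i) (Fin.suc j) eq = cong Fin.suc (lookup-injective u i j eq)

  sum-suc : ∀ {k} (f : Fin k → ℕ) → ℕΣ.sum (suc ∘ f) ≡ k ℕ.+ ℕΣ.sum f
  sum-suc {zero}  f = refl
  sum-suc {suc k} f = cong suc (begin
    f₀ ℕ.+ ℕΣ.sum (suc ∘ f ∘ Fin.suc)  ≡⟨ cong (f₀ ℕ.+_) (sum-suc (f ∘ Fin.suc)) ⟩
    f₀ ℕ.+ (k ℕ.+ S)                   ≡⟨ sym (+-assoc f₀ k S) ⟩
    (f₀ ℕ.+ k) ℕ.+ S                   ≡⟨ cong (ℕ._+ S) (+-comm f₀ k) ⟩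
    (k ℕ.+ f₀) ℕ.+ S                   ≡⟨ +-assoc k f₀ S ⟩
    k ℕ.+ (f₀ ℕ.+ S)                   ∎)
    where
    open ≡-Reasoning
    f₀ = f Fin.zero
    S = ℕΣ.sum (f ∘ Fin.suc)

  sum-toℕ : ∀ n → ℕΣ.sum (toℕ {n}) ≡ n C 2
  sum-toℕ zero    = refl
  sum-toℕ (suc n) = begin
    ℕΣ.sum (suc ∘ toℕ {n})  ≡⟨ sum-suc (toℕ {n}) ⟩
    n ℕ.+ ℕΣ.sum (toℕ {n})  ≡⟨ cong₂ ℕ._+_ (sym (nC1≡n n)) (sum-toℕ n) ⟩
    n C 1 ℕ.+ n C 2         ≡⟨ nCk+nC[k+1]≡[n+1]C[k+1] n 1 ⟩
    suc n C 2               ∎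
    where open ≡-Reasoning

  module _ (n : ℕ) where

    edgeBlock : Fin n → Fin n → List (Fin n × Fin n)
    edgeBlock b a = if toℕ a <ᵇ toℕ b then (a , b) ∷ [] else []

    edgeRow : Fin n → List (Fin n × Fin n)
    edgeRow b = concatMap (edgeBlock b) (allFin n)

    ∈-edgeBlock : ∀ b a {v} → v ∈ edgeBlock b a → v ≡ (a , b) × toℕ a < toℕ b
    ∈-edgeBlock b a v∈ with toℕ a <ᵇ toℕ b | <ᵇ-reflects-< (toℕ a) (toℕ b)
    ∈-edgeBlock b a (here v≡ab) | true | ofʸ a<b = v≡ab , a<b

    edgeBlock-unique : ∀ b a → Unique (edgeBlock b a)
    edgeBlock-unique b a with toℕ a <ᵇ toℕ b
    ... | true  = []ᴬ ∷ []
    ... | false = []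

    edgeBlock-length : ∀ b a → length (edgeBlock b a) ≡ (if toℕ a <ᵇ toℕ b then 1 else 0)
    edgeBlock-length b a with toℕ a <ᵇ toℕ b
    ... | true  = refl
    ... | false = refl

    ∈-edges⁻ : ∀ {v} → v ∈ edges n → toℕ (proj₁ v) < toℕ (proj₂ v)
    ∈-edges⁻ v∈ with ∈-concatMap-allFin⁻ edgeRow v∈
    ... | b , v∈row with ∈-concatMap-allFin⁻ (edgeBlock b) v∈row
    ...   | a , v∈block with ∈-edgeBlock b a v∈block
    ...     | refl , a<b = a<b

    ∈-edges⁺ : ∀ a b → toℕ a < toℕ b → (a , b) ∈ edges n
    ∈-edges⁺ a b a<b = ∈-concatMap-allFin⁺ edgeRow b (∈-concatMap-allFin⁺ (edgeBlock b) a ab∈block)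
      where
      ab∈block : (a , b) ∈ edgeBlock b a
      ab∈block with toℕ a <ᵇ toℕ b | <ᵇ-reflects-< (toℕ a) (toℕ b)
      ... | true  | _       = here refl
      ... | false | ofⁿ a≮b = ⊥-elim (a≮b a<b)

    edges-unique : Unique (edges n)
    edges-unique = Unique-concatMap-allFin edgeRow proj₂ row-end (λ b →
      Unique-concatMap-allFin (edgeBlock b) proj₁ (λ a v∈ → cong proj₁ (proj₁ (∈-edgeBlock b a v∈))) (edgeBlock-unique b))
      where
      row-end : ∀ b {v} → v ∈ edgeRow b → proj₂ v ≡ b
      row-end b v∈ with ∈-concatMap-allFin⁻ (edgeBlock b) v∈
      ... | a , v∈block = cong proj₂ (proj₁ (∈-edgeBlock b a v∈block))

  count-below : ∀ {n} (b : Fin n) → ℕΣ.sum (λ (a : Fin n) → if toℕ a <ᵇ toℕ b then 1 else 0) ≡ toℕ b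
  count-below {suc n} Fin.zero    = ℕΣ.sum-replicate-zero n
  count-below {suc n} (Fin.suc b) = cong suc (count-below b)

  E≡nC2 : ∀ n → E n ≡ n C 2
  E≡nC2 n = begin
    length (edges n)                     ≡⟨ length-concatMap-tabulate (edgeRow n) (λ b → b) ⟩
    ℕΣ.sum (λ b → length (edgeRow n b))  ≡⟨ ℕΣ.sum-cong-≗ {n} {λ b → length (edgeRow n b)} row-length ⟩
    ℕΣ.sum (toℕ {n})                     ≡⟨ sum-toℕ n ⟩
    n C 2                                ∎
    where
    open ≡-Reasoning
    row-length : ∀ b → length (edgeRow n b) ≡ toℕ b
    row-length b = trans (length-concatMap-tabulate (edgeBlock n b) (λ a → a))
                         (trans (ℕΣ.sum-cong-≗ {n} {λ a → length (edgeBlock n b a)} (edgeBlock-length n b)) (count-below {n} b))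

  edge-ordered : ∀ n (e : Fin (E n)) → toℕ (proj₁ (List.lookup (edges n) e)) < toℕ (proj₂ (List.lookup (edges n) e))
  edge-ordered n e = ∈-edges⁻ n (∈-lookup e)

  edge-injective : ∀ n (e e′ : Fin (E n)) → List.lookup (edges n) e ≡ List.lookup (edges n) e′ → e ≡ e′
  edge-injective n = lookup-injective (edges-unique n)

  edge-index : ∀ n (a b : Fin n) → toℕ a < toℕ b → ∃ λ e → List.lookup (edges n) e ≡ (a , b)
  edge-index n a b a<b = index (∈-edges⁺ n a b a<b) , sym (Any.lookup-index (∈-edges⁺ n a b a<b))

open CompleteGraphEdges using (edge-ordered; edge-injective; edge-index; E≡nC2)

module CompleteGraph (n : ℕ) where

  ends : Fin (E n) → Fin n × Fin n
  ends = List.lookup (edges n)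

  ends-ordered : ∀ e → toℕ (proj₁ (ends e)) < toℕ (proj₂ (ends e))
  ends-ordered = edge-ordered n

  ends-injective : ∀ e e′ → ends e ≡ ends e′ → e ≡ e′
  ends-injective = edge-injective n

  covers : ∀ a b → a ≢ b → ∃ λ e → ends e ≡ (a , b) ⊎ ends e ≡ (b , a)
  covers a b a≢b with <-cmp (toℕ a) (toℕ b)
  ... | tri< a<b _ _ = map₂ inj₁ (edge-index n a b a<b)
  ... | tri≈ _ a≡b _ = ⊥-elim (a≢b (toℕ-injective a≡b))
  ... | tri> _ _ b<a = map₂ inj₂ (edge-index n b a b<a)

  open MatchingComplex ends covers public

  ends-distinct : ∀ e → proj₁ (ends e) ≢ proj₂ (ends e)
  ends-distinct e a≡b = <-irrefl (cong toℕ a≡b) (ends-ordered e)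

  other-end : ∀ {e w} → Touches e w → Σ[ u ∈ Fin n ] Touches e u × u ≢ w
  other-end {e} (inj₁ a≡w) = proj₂ (ends e) , inj₂ refl , λ b≡w → ends-distinct e (trans a≡w (sym b≡w))
  other-end {e} (inj₂ b≡w) = proj₁ (ends e) , inj₁ refl , λ a≡w → ends-distinct e (trans a≡w (sym b≡w))

  touching-both : ∀ {e x y} → Touches e x → Touches e y → x ≢ y → ends e ≡ (x , y) ⊎ ends e ≡ (y , x)
  touching-both (inj₁ refl) (inj₁ refl) x≢y = ⊥-elim (x≢y refl)
  touching-both (inj₁ refl) (inj₂ refl) _   = inj₁ refl
  touching-both (inj₂ refl) (inj₁ refl) _   = inj₂ refl
  touching-both (inj₂ refl) (inj₂ refl) x≢y = ⊥-elim (x≢y refl)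

  ends-not-opposite : ∀ {e e′ a b} → ends e ≡ (a , b) → ends e′ ≡ (b , a) → ⊥
  ends-not-opposite {e} {e′} e≡ab e′≡ba =
    <-asym (subst (λ p → toℕ (proj₁ p) < toℕ (proj₂ p)) e≡ab (ends-ordered e))
           (subst (λ p → toℕ (proj₁ p) < toℕ (proj₂ p)) e′≡ba (ends-ordered e′))

  edge-through : ∀ {e e′ x y} → x ≢ y → Touches e x → Touches e y → Touches e′ x → Touches e′ y → e ≡ e′
  edge-through {e} {e′} x≢y tx ty tx′ ty′ with touching-both tx ty x≢y | touching-both tx′ ty′ x≢y
  ... | inj₁ p | inj₁ q = ends-injective e e′ (trans p (sym q))
  ... | inj₂ p | inj₂ q = ends-injective e e′ (trans p (sym q))
  ... | inj₁ p | inj₂ q = ⊥-elim (ends-not-opposite p q)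
  ... | inj₂ p | inj₁ q = ⊥-elim (ends-not-opposite q p)

  no-third-end : ∀ {e x y z} → x ≢ y → z ≢ x → z ≢ y → Touches e x → Touches e y → ¬ Touches e z
  no-third-end x≢y z≢x z≢y tx ty tz with touching-both tx ty x≢y | tz
  ... | inj₁ refl | inj₁ refl = z≢x refl
  ... | inj₁ refl | inj₂ refl = z≢y refl
  ... | inj₂ refl | inj₁ refl = z≢y refl
  ... | inj₂ refl | inj₂ refl = z≢x refl

  adjacent-edge : ∀ {G : Graph n} {a b} → Adj G a b → Σ[ e ∈ Fin (E n) ] Present G e × Touches e a × Touches e b
  adjacent-edge (e , e∈G , inj₁ e≡ab) = e , []=⇒lookup e∈G , inj₁ (cong proj₁ e≡ab) , inj₂ (cong proj₂ e≡ab)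
  adjacent-edge (e , e∈G , inj₂ e≡ba) = e , []=⇒lookup e∈G , inj₂ (cong proj₂ e≡ba) , inj₁ (cong proj₁ e≡ba)

  isolated : ∀ {G : Graph n} {S w} → (∀ {y} e → y ∉ S → y ≢ w → Present G e → Touches e w → Touches e y → ⊥) →
    ∀ {y} → Reach n G S w y → y ≡ w
  isolated no-edge here = refl
  isolated {w = w} no-edge (step {w = y} r adj y∉S) with isolated no-edge r
  ... | refl with adjacent-edge adj | y ≟ᶠ w
  ...   | _                   | yes y≡w = y≡w
  ...   | e , e∈G , tw , ty   | no y≢w  = ⊥-elim (no-edge e y∉S y≢w e∈G tw ty)

  co-edges-meet⇒disconnected : ∀ {σ} → CoEdgesMeet σ → ¬ IConnected n (n ∸ 2) σ
  co-edges-meet⇒disconnected {σ} (e , e′ , w , e∉σ , e′∉σ , e≢e′ , tw , tw′) connected with other-end tw | other-end tw′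
  ... | u , tu , u≢w | u′ , tu′ , u′≢w = u≢w (isolated no-edge (connected S small w u (Missing⇒∉ w∉S) (Missing⇒∉ u∉S)))
    where
    u≢u′ : u ≢ u′
    u≢u′ refl = e≢e′ (edge-through (u≢w ∘ sym) tw tu tw′ tu′)
    S₁ = ⊤ [ w ]≔ false
    S₂ = S₁ [ u ]≔ false
    S = S₂ [ u′ ]≔ false
    w∉S : Missing S w
    w∉S = Missing-remove⁺ S₂ (Missing-remove⁺ S₁ (lookup∘update w ⊤ false))
    u∉S : Missing S u
    u∉S = Missing-remove⁺ S₂ (lookup∘update u S₁ false)
    size≡ : suc (suc (suc ∣ S ∣)) ≡ n
    size≡ = begin
      suc (suc (suc ∣ S ∣))
        ≡⟨ cong (suc ∘ suc) (size-remove S₂ u′ (Present-remove⁺ S₁ (u≢u′ ∘ sym) (Present-remove⁺ ⊤ u′≢w (lookup-replicate u′ true)))) ⟩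
      suc (suc ∣ S₂ ∣)       ≡⟨ cong suc (size-remove S₁ u (Present-remove⁺ ⊤ u≢w (lookup-replicate u true))) ⟩
      suc ∣ S₁ ∣             ≡⟨ size-remove ⊤ w (lookup-replicate w true) ⟩
      ∣ ⊤ {n} ∣              ≡⟨ ∣⊤∣≡n n ⟩
      n                      ∎
      where open ≡-Reasoning
    small : ∣ S ∣ < n ∸ 2
    small = subst (λ k → ∣ S ∣ < k ∸ 2) size≡ (n<1+n ∣ S ∣)
    no-edge : ∀ {y} e″ → y ∉ S → y ≢ w → Present σ e″ → Touches e″ w → Touches e″ y → ⊥
    no-edge {y} e″ y∉S y≢w e″∈σ t″w t″y with Missing-remove S₂ (∉⇒Missing y∉S)
    ... | inj₁ refl = true≢false (trans (sym e″∈σ) (subst (Missing σ) (edge-through (u′≢w ∘ sym) tw′ tu′ t″w t″y) e′∉σ))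
    ... | inj₂ y∉S₂ with Missing-remove S₁ y∉S₂
    ...   | inj₁ refl = true≢false (trans (sym e″∈σ) (subst (Missing σ) (edge-through (u≢w ∘ sym) tw tu t″w t″y) e∉σ))
    ...   | inj₂ y∉S₁ with Missing-remove ⊤ y∉S₁
    ...     | inj₁ y≡w = y≢w y≡w
    ...     | inj₂ y∉⊤ = true≢false (trans (sym (lookup-replicate y true)) y∉⊤)

  covered-touches : ∀ {e a b} → ends e ≡ (a , b) ⊎ ends e ≡ (b , a) → Touches e a × Touches e b
  covered-touches (inj₁ e≡ab) = inj₁ (cong proj₁ e≡ab) , inj₂ (cong proj₂ e≡ab)
  covered-touches (inj₂ e≡ba) = inj₂ (cong proj₂ e≡ba) , inj₁ (cong proj₁ e≡ba)

  present-beside : ∀ {σ e₀ e x} → ¬ CoEdgesMeet σ → Missing σ e₀ → e ≢ e₀ → Touches e₀ x → Touches e x → Present σ e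
  present-beside {σ} {e = e} ¬meet e₀∉σ e≢e₀ t₀ t with lookup σ e in e∈σ
  ... | true  = refl
  ... | false = ⊥-elim (¬meet (e , _ , _ , e∈σ , e₀∉σ , e≢e₀ , t , t₀))

  three-missing : ∀ (S : Subset n) → ∣ S ∣ < n ∸ 2 → 3 ≤ missingCount S
  three-missing S small = +-cancelˡ-≤ ∣ S ∣ 3 (missingCount S) (subst₂ _≤_ S+2≡S+3 (sym (size+missingCount S)) S+2≤n)
    where
    S+2≡S+3 : suc ∣ S ∣ ℕ.+ 2 ≡ ∣ S ∣ ℕ.+ 3
    S+2≡S+3 = trans (+-comm (suc ∣ S ∣) 2) (+-comm 3 ∣ S ∣)
    2<n : 2 < n
    2<n = m∸n≢0⇒n<m (λ n∸2≡0 → case subst (∣ S ∣ <_) n∸2≡0 small of λ ())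
    S+2≤n : suc ∣ S ∣ ℕ.+ 2 ≤ n
    S+2≤n = m≤o∸n⇒m+n≤o (suc ∣ S ∣) (<⇒≤ 2<n) small

  vertex-outside : ∀ (S : Subset n) → ∣ S ∣ < n ∸ 2 → ∀ u v → Σ[ w ∈ Fin n ] Missing S w × w ≢ u × w ≢ v
  vertex-outside S small u v
    with some-missing ((S [ u ]≔ true) [ v ]≔ true) (≤-pred (≤-pred (≤-trans (three-missing S small) (missingCount-insert₂ S u v))))
  ... | w , w∉Suv with Missing-insert (S [ u ]≔ true) w∉Suv
  ...   | w≢v , w∉Su with Missing-insert S w∉Su
  ...     | w≢u , w∉S = w , w∉S , w≢u , w≢v

  co-matching⇒connected : ∀ {σ} → ¬ CoEdgesMeet σ → IConnected n (n ∸ 2) σ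
  co-matching⇒connected {σ} ¬meet S small u v u∉S v∉S with u ≟ᶠ v
  ... | yes refl = here
  ... | no u≢v with covers u v u≢v
  ...   | e₀ , e₀-uv with lookup σ e₀ in e₀∈σ
  ...     | true  = step here (e₀ , lookup⇒[]= e₀ σ e₀∈σ , e₀-uv) v∉S
  ...     | false with vertex-outside S small u v
  ...       | w , w∉S , w≢u , w≢v with covers u w (w≢u ∘ sym) | covers w v w≢v
  ...         | e₁ , e₁-uw | e₂ , e₂-wv =
    step (step here (e₁ , lookup⇒[]= e₁ σ e₁∈σ , e₁-uw) (Missing⇒∉ w∉S)) (e₂ , lookup⇒[]= e₂ σ e₂∈σ , e₂-wv) v∉S
    where
    t₀ = covered-touches e₀-uv
    t₁ = covered-touches e₁-uw
    t₂ = covered-touches e₂-wv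
    e₁∈σ : Present σ e₁
    e₁∈σ = present-beside {σ} ¬meet e₀∈σ
             (λ { refl → no-third-end u≢v w≢u w≢v (proj₁ t₀) (proj₂ t₀) (proj₂ t₁) }) (proj₁ t₀) (proj₁ t₁)
    e₂∈σ : Present σ e₂
    e₂∈σ = present-beside {σ} ¬meet e₀∈σ
             (λ { refl → no-third-end u≢v w≢u w≢v (proj₁ t₀) (proj₂ t₀) (proj₁ t₂) }) (proj₂ t₀) (proj₂ t₂)

  DeltaFace⇔CoEdgesMeet : ∀ σ → DeltaFace n σ ⇔ CoEdgesMeet σ
  DeltaFace⇔CoEdgesMeet σ = mk⇔ face⇒meet co-edges-meet⇒disconnected
    where
    face⇒meet : DeltaFace n σ → CoEdgesMeet σ
    face⇒meet face with coEdgesMeet? σ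
    ... | yes meet = meet
    ... | no ¬meet = ⊥-elim (face (co-matching⇒connected ¬meet))

ReducedCohomVanishes-⇔ : ∀ {m i} {P Q : Subset m → Set} → (∀ σ → P σ ⇔ Q σ) →
  ReducedCohomVanishes m Q i → ReducedCohomVanishes m P i
ReducedCohomVanishes-⇔ P⇔Q vanishes f closed with vanishes f (λ τ q → closed τ (Equivalence.from (P⇔Q τ) q))
... | g , f≡δg = g , λ σ p → f≡δg σ (Equivalence.to (P⇔Q σ) p)

codimension≤ : ∀ m k i → m ∸ k ∸ 1 ≤ i → m ∸ suc (suc i) ≤ k ∸ 1
codimension≤ m k i h = begin
  m ∸ suc (suc i)                ≤⟨ ∸-monoˡ-≤ (suc (suc i)) m≤ ⟩
  (suc i ℕ.+ k) ∸ suc (suc i)    ≡⟨ cong ((suc i ℕ.+ k) ∸_) (+-comm 1 (suc i)) ⟩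
  (suc i ℕ.+ k) ∸ (suc i ℕ.+ 1)  ≡⟨ [m+n]∸[m+o]≡n∸o (suc i) k 1 ⟩
  k ∸ 1                          ∎
  where
  open ≤-Reasoning
  m≤ : m ≤ suc i ℕ.+ k
  m≤ = begin
    m              ≤⟨ m≤n+m∸n m k ⟩
    k ℕ.+ (m ∸ k)  ≤⟨ +-monoʳ-≤ k (≤-trans (m≤n+m∸n (m ∸ k) 1) (s≤s h)) ⟩
    k ℕ.+ suc i    ≡⟨ +-comm k (suc i) ⟩
    suc i ℕ.+ k    ∎

2+3c≤n : ∀ n k c → 3 ≤ n → k ℕ.* 3 ≤ suc n → c ≤ k ∸ 1 → 2 ℕ.+ 3 ℕ.* c ≤ n
2+3c≤n n zero    zero 3≤n _  _  = ≤-trans (s≤s (s≤s z≤n)) 3≤n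
2+3c≤n n (suc k) c    _   3k≤1+n c≤k = begin
  2 ℕ.+ 3 ℕ.* c   ≤⟨ +-monoʳ-≤ 2 (*-monoʳ-≤ 3 c≤k) ⟩
  2 ℕ.+ 3 ℕ.* k   ≡⟨ cong (2 ℕ.+_) (*-comm 3 k) ⟩
  2 ℕ.+ k ℕ.* 3   ≤⟨ ≤-pred 3k≤1+n ⟩
  n               ∎
  where open ≤-Reasoning

codimension-bound : ∀ n i → 3 ≤ n → n C 2 ∸ (suc n / 3) ∸ 1 ≤ i → 2 ℕ.+ 3 ℕ.* (n C 2 ∸ suc (suc i)) ≤ n
codimension-bound n i 3≤n h = 2+3c≤n n (suc n / 3) _ 3≤n (m/n*n≤m (suc n) 3) (codimension≤ (n C 2) (suc n / 3) i h)

corollary7p2 : (n : ℕ) → 3 ≤ n → (i : ℕ) →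
    n C 2 ∸ (suc n / 3) ∸ 1 ≤ i →
    ReducedCohomVanishes (E n) (DeltaFace n) i
corollary7p2 n 3≤n i h = ReducedCohomVanishes-⇔ DeltaFace⇔CoEdgesMeet (co-edges-meet-cohomology-vanishes i bound)
  where
  open CompleteGraph n
  bound : 2 ℕ.+ 3 ℕ.* (E n ∸ suc (suc i)) ≤ n
  bound = subst (λ m → 2 ℕ.+ 3 ℕ.* (m ∸ suc (suc i)) ≤ n) (sym (E≡nC2 n)) (codimension-bound n i 3≤n h)
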